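{- If $1\le N\le 16$, then there does not exist an antipodal $5$-design with $2N+1$ rational points for the Chebyshev measure $(1-t^2)^{ -1/2}dt/\pi$ on $(-1,1)$.
   Context: An $m$-design with $n$ points for a probability measure $w(t)dt$ on an interval $I$ is a set of $n$ pairwise distinct points $x_1,\dots,x_n\in I$ with $\frac1n\sum_i f(x_i)=\int_I f(t)w(t)dt$ for every real polynomial $f$ of degree at most $m$. It is rational if all $x_i\in\mathbb{Q}$ and antipodal if $\{x_i\}=\{ -x_i\}$. -}

module Defs where

open import Data.Nat as ℕ using (ℕ; zero; suc)
open import Data.Nat.Properties using (m^n≢0)
open import Data.Nat.Combinatorics using (_C_)
open import Data.Integer using (+_)
open import Data.Rational using (ℚ; 0ℚ; 1ℚ; _+_; _*_; -_; _/_; _<_)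
open import Data.Fin using (Fin; zero; suc; toℕ)
open import Data.Product using (Σ; ∃; _×_)
open import Relation.Binary.PropositionalEquality using (_≡_)
open import Function.Definitions using (Injective)

_^ℚ_ : ℚ → ℕ → ℚ
x ^ℚ zero  = 1ℚ
x ^ℚ suc k = x * (x ^ℚ k)

sumFin : (n : ℕ) → (Fin n → ℚ) → ℚ
sumFin zero    f = 0ℚ
sumFin (suc n) f = f zero + sumFin n (λ i → f (suc i))

-- a real polynomial of degree ≤ m, given by coefficients c_0..c_m
-- (restricted to rational coefficients)
Poly : ℕ → Set
Poly m = Fin (suc m) → ℚ

eval : {m : ℕ} → Poly m → ℚ → ℚ
eval {m} c x = sumFin (suc m) (λ k → c k * (x ^ℚ toℕ k))

-- Moments ∫_{-1}^{1} t^k (1-t^2)^{-1/2} dt/π of the Chebyshev measure: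
-- 0 for odd k, binom(2j,j)/4^j for k = 2j.
chebMoment : ℕ → ℚ
chebMoment k with k ℕ.% 2
... | zero  = _/_ (+ ((2 ℕ.* (k ℕ./ 2)) C (k ℕ./ 2))) (4 ℕ.^ (k ℕ./ 2)) {{m^n≢0 4 (k ℕ./ 2)}}
... | suc _ = 0ℚ

chebIntegral : {m : ℕ} → Poly m → ℚ
chebIntegral {m} c = sumFin (suc m) (λ k → c k * chebMoment (toℕ k))

IsChebDesign : (m n : ℕ) → .{{_ : ℕ.NonZero n}} → (Fin n → ℚ) → Set
IsChebDesign m n x =
  Injective _≡_ _≡_ x
  × (∀ i → (- 1ℚ < x i) × (x i < 1ℚ))
  × (∀ (f : Poly m) →
       (+ 1 / n) * sumFin n (λ i → eval f (x i)) ≡ chebIntegral f)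

IsAntipodal : {n : ℕ} → (Fin n → ℚ) → Set
IsAntipodal {n} x = (∀ i → ∃ λ j → x j ≡ - x i) × (∀ i → ∃ λ j → x i ≡ - x j)

{-# OPTIONS --safe #-}
-- Pairing each point with its negative, the positive points a₁, …, a_k (k ≤ N) of such a design
-- satisfy 2 Σ aᵢ² = n/2 and 2 Σ aᵢ⁴ = 3n/8, where n = 2N + 1 is odd.  Clearing denominators,
-- aᵢ = Pᵢ/Q, gives 4 Σ Pᵢ² = n Q² and 16 Σ Pᵢ⁴ = 3n Q⁴, and a 2-adic descent shows that this has
-- no solution with at most 16 nonzero Pᵢ.  Q is even, say Q = 2q; if all Pᵢ are even, halve
-- everything.  Otherwise, for odd q the equations contradict p⁴ ≡ p² (mod 4).  For even q,
-- Σ Pᵢ⁴ ≡ 0 (mod 16) and p⁴ ≡ 1 (mod 16) for odd p force exactly 16 odd Pᵢ; these exhaust the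
-- nonzero ones, and summing p⁴ + 1 ≡ 2p² (mod 64) over them contradicts the equations mod 64.
module Submission where

open import Defs
open import Data.Nat
  using (ℕ; zero; suc; _+_; _*_; _^_; _%_; _/_; _≤_; _<_; z≤n; s≤s; s≤s⁻¹; NonZero; ≢-nonZero; >-nonZero)
import Data.Nat.Properties as ℕP
open ℕP using (_≟_; ≤-refl; ≤-trans; ≤-antisym; +-mono-≤; +-mono-<-≤; <⇒≱; ≮⇒≥; 1+n≰n; m≤m+n; m≤n+m; m≤n⇒m<n∨m≡n;
  +-cancelˡ-≤; *-comm; *-monoʳ-≤; *-cancelˡ-≡; m<m*n; module ≤-Reasoning)
open import Data.Nat.DivMod
  using (_mod_; %-distribˡ-+; %-distribˡ-*; m%n%n≡m%n; m%n<n; m*n%n≡0; [m+kn]%n≡m%n; m*n/n≡m)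
open import Data.Nat.Divisibility using (m%n≡0⇒n∣m; ∣⇒≤)
open import Data.Nat.Induction using (<-wellFounded)
open import Data.Nat.Solver using (module +-*-Solver)
open import Data.Integer as ℤ using (+_; -[1+_])
import Data.Integer.Properties as ℤP
import Data.Rational as ℚ
open ℚ using (ℚ; 0ℚ; 1ℚ; mkℚ; toℚᵘ; ↥_; ↧ₙ_)
import Data.Rational.Properties as ℚP
open import Data.Rational.Unnormalised as ℚᵘ using (mkℚᵘ; *≡*) renaming (_≃_ to _≃ᵘ_)
import Data.Rational.Unnormalised.Properties as ℚᵘP
open import Data.Rational.Solver using () renaming (module +-*-Solver to ℚSolver)
open import Data.Fin using (Fin; zero; suc; toℕ; fromℕ<)
open import Data.Fin.Properties using (all?; toℕ-fromℕ<)
open import Data.Fin.Permutation using (Permutation′; permutation; _⟨$⟩ʳ_)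
open import Data.Product using (Σ; ∃; _×_; _,_; proj₁; proj₂)
open import Data.Sum using (_⊎_; inj₁; inj₂)
open import Data.Empty using (⊥)
open import Function using (_∘_)
open import Function.Definitions using (Injective)
open import Induction.WellFounded using (Acc; acc)
open import Level using (0ℓ)
open import Relation.Binary.Core using (Rel)
open import Relation.Binary.Definitions using (Decidable; tri<; tri≈; tri>)
open import Relation.Binary.PropositionalEquality
open import Relation.Nullary using (¬_; yes; no; contradiction)
open import Relation.Nullary.Decidable using (True; toWitness; ¬?)
open import Algebra.Bundles using (CommutativeRing; Ring)
open import Algebra.Properties.CommutativeSemigroup ℕP.*-commutativeSemigroup using (interchange)
open import Algebra.Properties.CommutativeSemigroup (CommutativeRing.*-commutativeSemigroup ℚP.+-*-commutativeRing)
  using () renaming (interchange to ℚ-interchange)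
open import Algebra.Properties.Ring ℚP.+-*-ring using () renaming (-‿involutive to ℚ-‿involutive)
open import Algebra.Properties.Semiring.Sum ℕP.+-*-semiring
  using (sum; sum-cong-≗; ∑-distrib-+; *-distribˡ-sum; sum-permute)
import Algebra.Properties.Semiring.Sum
module ℚΣ = Algebra.Properties.Semiring.Sum (Ring.semiring ℚP.+-*-ring)

module _ {M : ℕ} .{{_ : NonZero M}} where

  %-+-cong : ∀ {a a′ b b′} → a % M ≡ a′ % M → b % M ≡ b′ % M → (a + b) % M ≡ (a′ + b′) % M
  %-+-cong {a} {a′} {b} {b′} a≡a′ b≡b′ = begin
    (a + b) % M             ≡⟨ %-distribˡ-+ a b M ⟩
    (a % M + b % M) % M     ≡⟨ cong₂ (λ u v → (u + v) % M) a≡a′ b≡b′ ⟩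
    (a′ % M + b′ % M) % M   ≡⟨ %-distribˡ-+ a′ b′ M ⟨
    (a′ + b′) % M           ∎
    where open ≡-Reasoning

  %-*-cong : ∀ {a a′ b b′} → a % M ≡ a′ % M → b % M ≡ b′ % M → (a * b) % M ≡ (a′ * b′) % M
  %-*-cong {a} {a′} {b} {b′} a≡a′ b≡b′ = begin
    (a * b) % M             ≡⟨ %-distribˡ-* a b M ⟩
    (a % M * (b % M)) % M   ≡⟨ cong₂ (λ u v → (u * v) % M) a≡a′ b≡b′ ⟩
    (a′ % M * (b′ % M)) % M ≡⟨ %-distribˡ-* a′ b′ M ⟨
    (a′ * b′) % M           ∎
    where open ≡-Reasoning

  %-^-cong : ∀ {a a′} k → a % M ≡ a′ % M → (a ^ k) % M ≡ (a′ ^ k) % M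
  %-^-cong zero    a≡a′ = refl
  %-^-cong (suc k) a≡a′ = %-*-cong a≡a′ (%-^-cong k a≡a′)

  sum-%-cong : ∀ {n} {f g : Fin n → ℕ} → (∀ i → f i % M ≡ g i % M) → sum f % M ≡ sum g % M
  sum-%-cong {zero}  f≡g = refl
  sum-%-cong {suc n} f≡g = %-+-cong (f≡g zero) (sum-%-cong (f≡g ∘ suc))

sum-mono-≤ : ∀ {n} {f g : Fin n → ℕ} → (∀ i → f i ≤ g i) → sum f ≤ sum g
sum-mono-≤ {zero}  f≤g = z≤n
sum-mono-≤ {suc n} f≤g = +-mono-≤ (f≤g zero) (sum-mono-≤ (f≤g ∘ suc))

≤-sum : ∀ {n} (f : Fin n → ℕ) i → f i ≤ sum f
≤-sum f zero    = m≤m+n (f zero) _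
≤-sum f (suc i) = ≤-trans (≤-sum (f ∘ suc) i) (m≤n+m _ (f zero))

sum-≤-length : ∀ {n} {f : Fin n → ℕ} → (∀ i → f i ≤ 1) → sum f ≤ n
sum-≤-length {zero}  f≤1 = z≤n
sum-≤-length {suc n} f≤1 = +-mono-≤ (f≤1 zero) (sum-≤-length (f≤1 ∘ suc))

≤∧sum≥⇒≗ : ∀ {n} {f g : Fin n → ℕ} → (∀ i → f i ≤ g i) → sum g ≤ sum f → ∀ i → f i ≡ g i
≤∧sum≥⇒≗ {suc n} {f} {g} f≤g Σg≤Σf i with m≤n⇒m<n∨m≡n (f≤g zero)
... | inj₁ f₀<g₀ = contradiction Σg≤Σf (<⇒≱ (+-mono-<-≤ f₀<g₀ (sum-mono-≤ (f≤g ∘ suc))))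
≤∧sum≥⇒≗ f≤g Σg≤Σf zero    | inj₂ f₀≡g₀ = f₀≡g₀
≤∧sum≥⇒≗ {f = f} f≤g Σg≤Σf (suc i) | inj₂ f₀≡g₀ =
  ≤∧sum≥⇒≗ (f≤g ∘ suc) (+-cancelˡ-≤ (f zero) _ _ (subst (λ t → t + _ ≤ f zero + _) (sym f₀≡g₀) Σg≤Σf)) i

*-^-distrib : ∀ m n k → (m * n) ^ k ≡ m ^ k * n ^ k
*-^-distrib m n zero    = refl
*-^-distrib m n (suc k) = trans (cong (m * n *_) (*-^-distrib m n k)) (interchange m n (m ^ k) (n ^ k))

-- Congruences between polynomial expressions are proved by checking all M² pairs of residues:
-- the True argument of decide-mod is discharged by evaluation.
infixl 6 _⊕_
infixl 7 _⊗_
infixr 8 _⊛_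

data Expr : Set where
  X Y     : Expr
  lit     : ℕ → Expr
  _⊕_ _⊗_ : Expr → Expr → Expr
  _⊛_     : Expr → ℕ → Expr

⟦_⟧ : Expr → ℕ → ℕ → ℕ
⟦ X ⟧     a b = a
⟦ Y ⟧     a b = b
⟦ lit c ⟧ a b = c
⟦ e ⊕ f ⟧ a b = ⟦ e ⟧ a b + ⟦ f ⟧ a b
⟦ e ⊗ f ⟧ a b = ⟦ e ⟧ a b * ⟦ f ⟧ a b
⟦ e ⊛ k ⟧ a b = ⟦ e ⟧ a b ^ k

module _ (M : ℕ) .{{_ : NonZero M}} where

  ⟦⟧-%-cong : ∀ e {a a′ b b′} → a % M ≡ a′ % M → b % M ≡ b′ % M → ⟦ e ⟧ a b % M ≡ ⟦ e ⟧ a′ b′ % M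
  ⟦⟧-%-cong X       a≡a′ b≡b′ = a≡a′
  ⟦⟧-%-cong Y       a≡a′ b≡b′ = b≡b′
  ⟦⟧-%-cong (lit c) a≡a′ b≡b′ = refl
  ⟦⟧-%-cong (e ⊕ f) a≡a′ b≡b′ = %-+-cong (⟦⟧-%-cong e a≡a′ b≡b′) (⟦⟧-%-cong f a≡a′ b≡b′)
  ⟦⟧-%-cong (e ⊗ f) a≡a′ b≡b′ = %-*-cong (⟦⟧-%-cong e a≡a′ b≡b′) (⟦⟧-%-cong f a≡a′ b≡b′)
  ⟦⟧-%-cong (e ⊛ k) a≡a′ b≡b′ = %-^-cong k (⟦⟧-%-cong e a≡a′ b≡b′)

  decide-mod : (_~_ : Rel ℕ 0ℓ) (_~?_ : Decidable _~_) (e f : Expr) →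
    True (all? λ (i : Fin M) → all? λ (j : Fin M) →
      (⟦ e ⟧ (toℕ i) (toℕ j) % M) ~? (⟦ f ⟧ (toℕ i) (toℕ j) % M)) →
    ∀ a b → (⟦ e ⟧ a b % M) ~ (⟦ f ⟧ a b % M)
  decide-mod _~_ _ e f holds a b =
    subst₂ _~_ (reduce e) (reduce f) (toWitness holds (a mod M) (b mod M))
    where
    toℕ-mod : ∀ c → toℕ (c mod M) % M ≡ c % M
    toℕ-mod c = trans (cong (_% M) (toℕ-fromℕ< _)) (m%n%n≡m%n c M)
    reduce : ∀ e → ⟦ e ⟧ (toℕ (a mod M)) (toℕ (b mod M)) % M ≡ ⟦ e ⟧ a b % M
    reduce e = ⟦⟧-%-cong e (toℕ-mod a) (toℕ-mod b)

_≢?_ : Decidable {A = ℕ} (λ u v → u ≢ v)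
u ≢? v = ¬? (u ≟ v)

data Parity : ℕ → Set where
  even : ∀ k → Parity (k * 2)
  odd  : ∀ k → Parity (1 + k * 2)

parity : ∀ p → Parity p
parity zero = even 0
parity (suc p) with parity p
... | even k = odd k
... | odd k  = even (suc k)

even-or-odd : ∀ p → p ≡ p / 2 * 2 ⊎ p % 2 ≡ 1
even-or-odd p with parity p
... | even k = inj₁ (cong (_* 2) (sym (m*n/n≡m k 2)))
... | odd k  = inj₂ ([m+kn]%n≡m%n 1 k 2)

[_≢0] : ℕ → ℕ
[ zero  ≢0] = 0
[ suc _ ≢0] = 1

[≢0]≤1 : ∀ p → [ p ≢0] ≤ 1
[≢0]≤1 zero    = z≤n
[≢0]≤1 (suc p) = s≤s z≤n

%2≤[≢0] : ∀ p → p % 2 ≤ [ p ≢0]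
%2≤[≢0] zero    = z≤n
%2≤[≢0] (suc p) = s≤s⁻¹ (m%n<n (suc p) 2)

[*2≢0]≡[≢0] : ∀ p → [ p * 2 ≢0] ≡ [ p ≢0]
[*2≢0]≡[≢0] zero    = refl
[*2≢0]≡[≢0] (suc p) = refl

p⁴≡p²-mod-4 : ∀ p → p ^ 4 % 4 ≡ p ^ 2 % 4
p⁴≡p²-mod-4 p = decide-mod 4 _≡_ _≟_ (X ⊛ 4) (X ⊛ 2) _ p 0

p⁴≡p%2-mod-16 : ∀ p → p ^ 4 % 16 ≡ p % 2 % 16
p⁴≡p%2-mod-16 p with parity p
... | even k = trans (decide-mod 16 _≡_ _≟_ ((X ⊗ lit 2) ⊛ 4) (lit 0) _ k 0)
                     (cong (_% 16) (sym (m*n%n≡0 k 2)))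
... | odd k  = trans (decide-mod 16 _≡_ _≟_ ((lit 1 ⊕ X ⊗ lit 2) ⊛ 4) (lit 1) _ k 0)
                     (cong (_% 16) (sym ([m+kn]%n≡m%n 1 k 2)))

-- False for even p ≠ 0, which the hypothesis excludes.
p⁴+p%2≡2p²-mod-64 : ∀ p → p % 2 ≡ [ p ≢0] → (p ^ 4 + p % 2) % 64 ≡ 2 * p ^ 2 % 64
p⁴+p%2≡2p²-mod-64 p p%2≡[p≢0] with parity p
... | even zero    = refl
... | even (suc k) = contradiction (trans (sym (m*n%n≡0 (suc k) 2)) p%2≡[p≢0]) λ ()
... | odd k = trans (cong (λ r → ((1 + k * 2) ^ 4 + r) % 64) ([m+kn]%n≡m%n 1 k 2))
  (decide-mod 64 _≡_ _≟_ ((lit 1 ⊕ X ⊗ lit 2) ⊛ 4 ⊕ lit 1) (lit 2 ⊗ (lit 1 ⊕ X ⊗ lit 2) ⊛ 2) _ k 0)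

odd*odd²≢0-mod-4 : ∀ a b → (1 + a * 2) * (1 + b * 2) ^ 2 % 4 ≢ 0
odd*odd²≢0-mod-4 = decide-mod 4 _ _≢?_ ((lit 1 ⊕ X ⊗ lit 2) ⊗ (lit 1 ⊕ Y ⊗ lit 2) ⊛ 2) (lit 0) _

3odd*odd⁴≢odd*odd²-mod-4 : ∀ a b →
  3 * ((1 + a * 2) * (1 + b * 2) ^ 4) % 4 ≢ (1 + a * 2) * (1 + b * 2) ^ 2 % 4
3odd*odd⁴≢odd*odd²-mod-4 = decide-mod 4 _ _≢?_
  (lit 3 ⊗ ((lit 1 ⊕ X ⊗ lit 2) ⊗ (lit 1 ⊕ Y ⊗ lit 2) ⊛ 4))
  ((lit 1 ⊕ X ⊗ lit 2) ⊗ (lit 1 ⊕ Y ⊗ lit 2) ⊛ 2) _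

3m*even⁴≡0-mod-16 : ∀ m r → 3 * (m * (r * 2) ^ 4) % 16 ≡ 0
3m*even⁴≡0-mod-16 = decide-mod 16 _≡_ _≟_ (lit 3 ⊗ (X ⊗ (Y ⊗ lit 2) ⊛ 4)) (lit 0) _

3odd*even⁴+16≢2odd*even²-mod-64 : ∀ a r →
  (3 * ((1 + a * 2) * (r * 2) ^ 4) + 16) % 64 ≢ 2 * ((1 + a * 2) * (r * 2) ^ 2) % 64
3odd*even⁴+16≢2odd*even²-mod-64 = decide-mod 64 _ _≢?_
  (lit 3 ⊗ ((lit 1 ⊕ X ⊗ lit 2) ⊗ (Y ⊗ lit 2) ⊛ 4) ⊕ lit 16)
  (lit 2 ⊗ ((lit 1 ⊕ X ⊗ lit 2) ⊗ (Y ⊗ lit 2) ⊛ 2)) _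

module _ {n : ℕ} where

  powerSum : ℕ → (Fin n → ℕ) → ℕ
  powerSum k P = sum λ i → P i ^ k

  oddCount nonZeroCount : (Fin n → ℕ) → ℕ
  oddCount     P = sum λ i → P i % 2
  nonZeroCount P = sum λ i → [ P i ≢0]

  powerSum-*ʳ : ∀ k c (P : Fin n → ℕ) → powerSum k (λ i → P i * c) ≡ c ^ k * powerSum k P
  powerSum-*ʳ k c P = begin
    sum (λ i → (P i * c) ^ k)    ≡⟨ sum-cong-≗ (λ i → trans (*-^-distrib (P i) c k) (*-comm (P i ^ k) (c ^ k))) ⟩
    sum (λ i → c ^ k * P i ^ k)  ≡⟨ *-distribˡ-sum (c ^ k) (λ i → P i ^ k) ⟨
    c ^ k * powerSum k P         ∎
    where open ≡-Reasoning

  oddCount≤nonZeroCount : ∀ P → oddCount P ≤ nonZeroCount P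
  oddCount≤nonZeroCount P = sum-mono-≤ (%2≤[≢0] ∘ P)

all-even-or-some-odd : ∀ {n} (P : Fin n → ℕ) → (∀ i → P i ≡ P i / 2 * 2) ⊎ ∃ λ i → P i % 2 ≡ 1
all-even-or-some-odd {zero}  P = inj₁ λ ()
all-even-or-some-odd {suc n} P with even-or-odd (P zero) | all-even-or-some-odd (P ∘ suc)
... | inj₂ P₀-odd  | _               = inj₂ (zero , P₀-odd)
... | inj₁ _       | inj₂ (i , Pᵢ-odd) = inj₂ (suc i , Pᵢ-odd)
... | inj₁ P₀-even | inj₁ rest-even  = inj₁ λ { zero → P₀-even ; (suc i) → rest-even i }

oddCount≡16 : ∀ {n} (P : Fin n → ℕ) → nonZeroCount P ≤ 16 → (∃ λ i → P i % 2 ≡ 1) →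
  powerSum 4 P % 16 ≡ 0 → oddCount P ≡ 16
oddCount≡16 P supp (i , Pᵢ-odd) 16∣S₄ =
  ≤-antisym (≤-trans (oddCount≤nonZeroCount P) supp) (∣⇒≤ {{>-nonZero 0<c}} (m%n≡0⇒n∣m _ 16 16∣c))
  where
  0<c : 0 < oddCount P
  0<c = subst (_≤ oddCount P) Pᵢ-odd (≤-sum (λ j → P j % 2) i)
  16∣c : oddCount P % 16 ≡ 0
  16∣c = trans (sym (sum-%-cong (p⁴≡p%2-mod-16 ∘ P))) 16∣S₄

odd-entry-impossible : ∀ {n} (P : Fin n → ℕ) a q → nonZeroCount P ≤ 16 → (∃ λ i → P i % 2 ≡ 1) →
  powerSum 2 P ≡ (1 + a * 2) * q ^ 2 → powerSum 4 P ≡ 3 * ((1 + a * 2) * q ^ 4) → ⊥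
odd-entry-impossible P a q supp odd-entry S₂≡ S₄≡ with parity q
... | odd b = 3odd*odd⁴≢odd*odd²-mod-4 a b (begin
  3 * ((1 + a * 2) * (1 + b * 2) ^ 4) % 4  ≡⟨ cong (_% 4) S₄≡ ⟨
  powerSum 4 P % 4                         ≡⟨ sum-%-cong (p⁴≡p²-mod-4 ∘ P) ⟩
  powerSum 2 P % 4                         ≡⟨ cong (_% 4) S₂≡ ⟩
  (1 + a * 2) * (1 + b * 2) ^ 2 % 4        ∎)
  where open ≡-Reasoning
... | even r = 3odd*even⁴+16≢2odd*even²-mod-64 a r (begin
  (3 * ((1 + a * 2) * (r * 2) ^ 4) + 16) % 64  ≡⟨ cong₂ (λ s c → (s + c) % 64) S₄≡ c≡16 ⟨
  (powerSum 4 P + oddCount P) % 64             ≡⟨ cong (_% 64) (∑-distrib-+ (λ i → P i ^ 4) (λ i → P i % 2)) ⟨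
  sum (λ i → P i ^ 4 + P i % 2) % 64           ≡⟨ sum-%-cong (λ i → p⁴+p%2≡2p²-mod-64 (P i) (odd-or-zero i)) ⟩
  sum (λ i → 2 * P i ^ 2) % 64                 ≡⟨ cong (_% 64) (*-distribˡ-sum 2 (λ i → P i ^ 2)) ⟨
  2 * powerSum 2 P % 64                        ≡⟨ cong (λ s → 2 * s % 64) S₂≡ ⟩
  2 * ((1 + a * 2) * (r * 2) ^ 2) % 64         ∎)
  where
  open ≡-Reasoning
  c≡16 : oddCount P ≡ 16
  c≡16 = oddCount≡16 P supp odd-entry (trans (cong (_% 16) S₄≡) (3m*even⁴≡0-mod-16 (1 + a * 2) r))
  odd-or-zero : ∀ i → P i % 2 ≡ [ P i ≢0]
  odd-or-zero = ≤∧sum≥⇒≗ (%2≤[≢0] ∘ P) (subst (nonZeroCount P ≤_) (sym c≡16) supp)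

cancel-even-Q : ∀ m q {s₂ s₄} → 4 * s₂ ≡ m * (q * 2) ^ 2 → 16 * s₄ ≡ 3 * (m * (q * 2) ^ 4) →
  s₂ ≡ m * q ^ 2 × s₄ ≡ 3 * (m * q ^ 4)
cancel-even-Q m q e₂ e₄ =
  *-cancelˡ-≡ _ _ 4 (trans e₂ (solve 2 (λ m q → m :* (q :* con 2) :^ 2 := con 4 :* (m :* q :^ 2)) refl m q)) ,
  *-cancelˡ-≡ _ _ 16 (trans e₄ (solve 2 (λ m q → con 3 :* (m :* (q :* con 2) :^ 4)
                                             := con 16 :* (con 3 :* (m :* q :^ 4))) refl m q))
  where open +-*-Solver

power-sum-equations-unsolvable : ∀ {n} (P : Fin n → ℕ) a Q → Q ≢ 0 → nonZeroCount P ≤ 16 →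
  4 * powerSum 2 P ≡ (1 + a * 2) * Q ^ 2 → 16 * powerSum 4 P ≡ 3 * ((1 + a * 2) * Q ^ 4) → ⊥
power-sum-equations-unsolvable {n} P a Q = descent Q (<-wellFounded Q) P
  where
  m : ℕ
  m = 1 + a * 2
  descent : ∀ Q → Acc _<_ Q → ∀ (P : Fin n → ℕ) → Q ≢ 0 → nonZeroCount P ≤ 16 →
    4 * powerSum 2 P ≡ m * Q ^ 2 → 16 * powerSum 4 P ≡ 3 * (m * Q ^ 4) → ⊥
  descent Q (acc smaller) P Q≢0 supp e₂ e₄ with parity Q
  ... | odd b = odd*odd²≢0-mod-4 a b (trans (cong (_% 4) (sym e₂)) 4∣4*S₂)
    where
    4∣4*S₂ : 4 * powerSum 2 P % 4 ≡ 0
    4∣4*S₂ = trans (cong (_% 4) (*-comm 4 (powerSum 2 P))) (m*n%n≡0 (powerSum 2 P) 4)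
  ... | even q = continue (cancel-even-Q m q e₂ e₄) (all-even-or-some-odd P)
    where
    continue : powerSum 2 P ≡ m * q ^ 2 × powerSum 4 P ≡ 3 * (m * q ^ 4) →
      (∀ i → P i ≡ P i / 2 * 2) ⊎ (∃ λ i → P i % 2 ≡ 1) → ⊥
    continue (S₂≡ , S₄≡) (inj₂ odd-entry) = odd-entry-impossible P a q supp odd-entry S₂≡ S₄≡
    continue (S₂≡ , S₄≡) (inj₁ P-even) =
      descent q (smaller q<2q) P′ q≢0 supp′
        (trans (sym (powerSum-halve 2)) S₂≡) (trans (sym (powerSum-halve 4)) S₄≡)
      where
      P′ : Fin n → ℕ
      P′ i = P i / 2
      powerSum-halve : ∀ k → powerSum k P ≡ 2 ^ k * powerSum k P′
      powerSum-halve k = trans (sum-cong-≗ (λ i → cong (_^ k) (P-even i))) (powerSum-*ʳ k 2 P′)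
      supp′ : nonZeroCount P′ ≤ 16
      supp′ = subst (_≤ 16) (sum-cong-≗ λ i → trans (cong [_≢0] (P-even i)) ([*2≢0]≡[≢0] (P′ i))) supp
      q≢0 : q ≢ 0
      q≢0 refl = Q≢0 refl
      q<2q : q < q * 2
      q<2q = m<m*n q 2 {{≢-nonZero q≢0}} (s≤s (s≤s z≤n))

fromℕ : ℕ → ℚ
fromℕ k = + k ℚ./ 1

toℚᵘ-fromℕ : ∀ k → toℚᵘ (fromℕ k) ≃ᵘ mkℚᵘ (+ k) 0
toℚᵘ-fromℕ k = ℚP.toℚᵘ-fromℚᵘ (mkℚᵘ (+ k) 0)

fromℕ-+ : ∀ a b → fromℕ (a + b) ≡ fromℕ a ℚ.+ fromℕ b
fromℕ-+ a b = ℚP.toℚᵘ-injective (begin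
  toℚᵘ (fromℕ (a + b))                  ≈⟨ toℚᵘ-fromℕ (a + b) ⟩
  mkℚᵘ (+ (a + b)) 0                    ≈⟨ *≡* (cong (ℤ._* + 1) (trans (ℤP.pos-+ a b)
                                             (sym (cong₂ ℤ._+_ (ℤP.*-identityʳ (+ a)) (ℤP.*-identityʳ (+ b)))))) ⟩
  mkℚᵘ (+ a) 0 ℚᵘ.+ mkℚᵘ (+ b) 0        ≈⟨ ℚᵘP.+-cong (toℚᵘ-fromℕ a) (toℚᵘ-fromℕ b) ⟨
  toℚᵘ (fromℕ a) ℚᵘ.+ toℚᵘ (fromℕ b)    ≈⟨ ℚP.toℚᵘ-homo-+ (fromℕ a) (fromℕ b) ⟨
  toℚᵘ (fromℕ a ℚ.+ fromℕ b)            ∎)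
  where open ℚᵘP.≃-Reasoning

fromℕ-* : ∀ a b → fromℕ (a * b) ≡ fromℕ a ℚ.* fromℕ b
fromℕ-* a b = ℚP.toℚᵘ-injective (begin
  toℚᵘ (fromℕ (a * b))                  ≈⟨ toℚᵘ-fromℕ (a * b) ⟩
  mkℚᵘ (+ (a * b)) 0                    ≈⟨ *≡* (cong (ℤ._* + 1) (ℤP.pos-* a b)) ⟩
  mkℚᵘ (+ a) 0 ℚᵘ.* mkℚᵘ (+ b) 0        ≈⟨ ℚᵘP.*-cong (toℚᵘ-fromℕ a) (toℚᵘ-fromℕ b) ⟨
  toℚᵘ (fromℕ a) ℚᵘ.* toℚᵘ (fromℕ b)    ≈⟨ ℚP.toℚᵘ-homo-* (fromℕ a) (fromℕ b) ⟨
  toℚᵘ (fromℕ a ℚ.* fromℕ b)            ∎)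
  where open ℚᵘP.≃-Reasoning

fromℕ-injective : ∀ {a b} → fromℕ a ≡ fromℕ b → a ≡ b
fromℕ-injective {a} {b} eq
  with ℚᵘP.≃-trans (ℚᵘP.≃-sym (toℚᵘ-fromℕ a)) (ℚᵘP.≃-trans (ℚP.toℚᵘ-cong eq) (toℚᵘ-fromℕ b))
... | *≡* a≡b = ℤP.+-injective (trans (sym (ℤP.*-identityʳ (+ a))) (trans a≡b (ℤP.*-identityʳ (+ b))))

fromℕ*[1/n]≡1 : ∀ n .{{_ : NonZero n}} → fromℕ n ℚ.* (+ 1 ℚ./ n) ≡ 1ℚ
fromℕ*[1/n]≡1 (suc n) = ℚP.toℚᵘ-injective (begin
  toℚᵘ (fromℕ (suc n) ℚ.* (+ 1 ℚ./ suc n))         ≈⟨ ℚP.toℚᵘ-homo-* (fromℕ (suc n)) (+ 1 ℚ./ suc n) ⟩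
  toℚᵘ (fromℕ (suc n)) ℚᵘ.* toℚᵘ (+ 1 ℚ./ suc n)
    ≈⟨ ℚᵘP.*-cong (toℚᵘ-fromℕ (suc n)) (ℚP.toℚᵘ-fromℚᵘ (mkℚᵘ (+ 1) n)) ⟩
  mkℚᵘ (+ suc n) 0 ℚᵘ.* mkℚᵘ (+ 1) n               ≈⟨ ℚᵘP.*-inverseʳ (mkℚᵘ (+ suc n) 0) ⟩
  ℚᵘ.1ℚᵘ                                           ∎)
  where open ℚᵘP.≃-Reasoning

fromℕ-sum : ∀ {n} (f : Fin n → ℕ) → fromℕ (sum f) ≡ ℚΣ.sum (fromℕ ∘ f)
fromℕ-sum {zero}  f = refl
fromℕ-sum {suc n} f = trans (fromℕ-+ (f zero) _) (cong (fromℕ (f zero) ℚ.+_) (fromℕ-sum (f ∘ suc)))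

fromℕ-^ : ∀ p k → fromℕ (p ^ k) ≡ fromℕ p ^ℚ k
fromℕ-^ p zero    = refl
fromℕ-^ p (suc k) = trans (fromℕ-* p (p ^ k)) (cong (fromℕ p ℚ.*_) (fromℕ-^ p k))

*-^ℚ-distrib : ∀ a b k → (a ℚ.* b) ^ℚ k ≡ a ^ℚ k ℚ.* b ^ℚ k
*-^ℚ-distrib a b zero    = refl
*-^ℚ-distrib a b (suc k) =
  trans (cong (a ℚ.* b ℚ.*_) (*-^ℚ-distrib a b k)) (ℚ-interchange a b (a ^ℚ k) (b ^ℚ k))

neg-^ℚ-even : ∀ y k → (ℚ.- y) ^ℚ (k * 2) ≡ y ^ℚ (k * 2)
neg-^ℚ-even y zero    = refl
neg-^ℚ-even y (suc k) rewrite neg-^ℚ-even y k =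
  solve 2 (λ y z → (:- y) :* ((:- y) :* z) := y :* (y :* z)) refl y (y ^ℚ (k * 2))
  where open ℚSolver

sumFin≡sum : ∀ n (f : Fin n → ℚ) → sumFin n f ≡ ℚΣ.sum f
sumFin≡sum zero    f = refl
sumFin≡sum (suc n) f = cong (f zero ℚ.+_) (sumFin≡sum n (f ∘ suc))

nonneg-*-denominator : ∀ a → 0ℚ ℚ.≤ a → a ℚ.* fromℕ (↧ₙ a) ≡ fromℕ ℤ.∣ ↥ a ∣
nonneg-*-denominator a@(mkℚ (+ p) d _) _ = ℚP.toℚᵘ-injective (begin
  toℚᵘ (a ℚ.* fromℕ (suc d))            ≈⟨ ℚP.toℚᵘ-homo-* a (fromℕ (suc d)) ⟩
  mkℚᵘ (+ p) d ℚᵘ.* toℚᵘ (fromℕ (suc d)) ≈⟨ ℚᵘP.*-congˡ {mkℚᵘ (+ p) d} (toℚᵘ-fromℕ (suc d)) ⟩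
  mkℚᵘ (+ p) d ℚᵘ.* mkℚᵘ (+ suc d) 0
    ≈⟨ *≡* (trans (ℤP.*-identityʳ _) (cong (λ e → + p ℤ.* + e) (sym (ℕP.*-identityʳ (suc d))))) ⟩
  mkℚᵘ (+ p) 0                          ≈⟨ toℚᵘ-fromℕ p ⟨
  toℚᵘ (fromℕ p)                        ∎)
  where open ℚᵘP.≃-Reasoning
nonneg-*-denominator (mkℚ -[1+ _ ] _ _) (ℚ.*≤* ())

common-denominator : ∀ {n} (a : Fin n → ℚ) → (∀ i → 0ℚ ℚ.≤ a i) →
  Σ ℕ λ Q → Q ≢ 0 × Σ (Fin n → ℕ) λ P → ∀ i → a i ℚ.* fromℕ Q ≡ fromℕ (P i)
common-denominator {zero}  a a≥0 = 1 , (λ ()) , (λ ()) , (λ ())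
common-denominator {suc n} a a≥0 with common-denominator (a ∘ suc) (a≥0 ∘ suc)
... | Q , Q≢0 , P , aQ≡P = Q * d , Q≢0 ∘ ℕP.m*n≡0⇒m≡0 Q d , P′ , aQd≡P′
  where
  d : ℕ
  d = ↧ₙ a zero
  P′ : Fin (suc n) → ℕ
  P′ zero    = ℤ.∣ ↥ a zero ∣ * Q
  P′ (suc i) = P i * d
  aQd≡P′ : ∀ i → a i ℚ.* fromℕ (Q * d) ≡ fromℕ (P′ i)
  aQd≡P′ zero = begin
    a zero ℚ.* fromℕ (Q * d)
      ≡⟨ cong (a zero ℚ.*_) (trans (fromℕ-* Q d) (ℚP.*-comm (fromℕ Q) (fromℕ d))) ⟩
    a zero ℚ.* (fromℕ d ℚ.* fromℕ Q)       ≡⟨ ℚP.*-assoc (a zero) (fromℕ d) (fromℕ Q) ⟨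
    a zero ℚ.* fromℕ d ℚ.* fromℕ Q         ≡⟨ cong (ℚ._* fromℕ Q) (nonneg-*-denominator (a zero) (a≥0 zero)) ⟩
    fromℕ ℤ.∣ ↥ a zero ∣ ℚ.* fromℕ Q       ≡⟨ fromℕ-* ℤ.∣ ↥ a zero ∣ Q ⟨
    fromℕ (P′ zero)                        ∎
    where open ≡-Reasoning
  aQd≡P′ (suc i) = begin
    a (suc i) ℚ.* fromℕ (Q * d)            ≡⟨ cong (a (suc i) ℚ.*_) (fromℕ-* Q d) ⟩
    a (suc i) ℚ.* (fromℕ Q ℚ.* fromℕ d)    ≡⟨ ℚP.*-assoc (a (suc i)) (fromℕ Q) (fromℕ d) ⟨
    a (suc i) ℚ.* fromℕ Q ℚ.* fromℕ d      ≡⟨ cong (ℚ._* fromℕ d) (aQ≡P i) ⟩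
    fromℕ (P i) ℚ.* fromℕ d                ≡⟨ fromℕ-* (P i) d ⟨
    fromℕ (P′ (suc i))                     ∎
    where open ≡-Reasoning

infix 25 _⁺
_⁺ : ℚ → ℚ
y ⁺ with 0ℚ ℚP.<? y
... | yes _ = y
... | no  _ = 0ℚ

[0<_] : ℚ → ℕ
[0< y ] with 0ℚ ℚP.<? y
... | yes _ = 1
... | no  _ = 0

⁺-nonneg : ∀ y → 0ℚ ℚ.≤ y ⁺
⁺-nonneg y with 0ℚ ℚP.<? y
... | yes 0<y = ℚP.<⇒≤ 0<y
... | no  _   = ℚP.≤-refl

0<y⇒0≮-y : ∀ {y} → 0ℚ ℚ.< y → ¬ 0ℚ ℚ.< ℚ.- y
0<y⇒0≮-y 0<y 0<-y = ℚP.<-asym 0<-y (ℚP.neg-antimono-< 0<y)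

[0<y]+[0<-y]≤1 : ∀ y → [0< y ] + [0< ℚ.- y ] ≤ 1
[0<y]+[0<-y]≤1 y with 0ℚ ℚP.<? y | 0ℚ ℚP.<? ℚ.- y
... | yes 0<y | yes 0<-y = contradiction 0<-y (0<y⇒0≮-y 0<y)
... | yes _   | no  _    = ≤-refl
... | no  _   | yes _    = ≤-refl
... | no  _   | no  _    = z≤n

even-split : ∀ (g : ℚ → ℚ) → g 0ℚ ≡ 0ℚ → (∀ y → g (ℚ.- y) ≡ g y) →
  ∀ y → g y ≡ g (y ⁺) ℚ.+ g ((ℚ.- y) ⁺)
even-split g g0≡0 g-even y with 0ℚ ℚP.<? y | 0ℚ ℚP.<? ℚ.- y
... | yes 0<y | yes 0<-y = contradiction 0<-y (0<y⇒0≮-y 0<y)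
... | yes _   | no  _    = trans (sym (ℚP.+-identityʳ (g y))) (cong (g y ℚ.+_) (sym g0≡0))
... | no  _   | yes _    =
  trans (sym (g-even y)) (trans (sym (ℚP.+-identityˡ _)) (cong (ℚ._+ g (ℚ.- y)) (sym g0≡0)))
... | no  0≮y | no  0≮-y = trans (cong g y≡0) (trans g0≡0 (sym (cong₂ ℚ._+_ g0≡0 g0≡0)))
  where
  y≡0 : y ≡ 0ℚ
  y≡0 with ℚP.<-cmp 0ℚ y
  ... | tri< 0<y _ _ = contradiction 0<y 0≮y
  ... | tri≈ _ 0≡y _ = sym 0≡y
  ... | tri> _ _ y<0 = contradiction (ℚP.neg-antimono-< y<0) 0≮-y

[≢0]≤[0<] : ∀ y {Q p} → y ⁺ ℚ.* fromℕ Q ≡ fromℕ p → [ p ≢0] ≤ [0< y ]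
[≢0]≤[0<] y {Q} {p} y⁺Q≡p with 0ℚ ℚP.<? y
... | yes _ = [≢0]≤1 p
... | no  _ = subst (λ p → [ p ≢0] ≤ 0) (sym (fromℕ-injective (trans (sym y⁺Q≡p) (ℚP.*-zeroˡ (fromℕ Q))))) z≤n

reflection : ∀ {n} {x : Fin n → ℚ} → Injective _≡_ _≡_ x → (∀ i → ∃ λ j → x j ≡ ℚ.- x i) →
  Σ (Permutation′ n) λ π → ∀ i → x (π ⟨$⟩ʳ i) ≡ ℚ.- x i
reflection {n} {x} x-injective antipode = permutation σ σ σ∘σ≗id σ∘σ≗id , proj₂ ∘ antipode
  where
  σ : Fin n → Fin n
  σ = proj₁ ∘ antipode
  σ∘σ≗id : ∀ i → σ (σ i) ≡ i
  σ∘σ≗id i = x-injective (begin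
    x (σ (σ i))   ≡⟨ proj₂ (antipode (σ i)) ⟩
    ℚ.- x (σ i)   ≡⟨ cong ℚ.-_ (proj₂ (antipode i)) ⟩
    ℚ.- ℚ.- x i   ≡⟨ ℚ-‿involutive (x i) ⟩
    x i           ∎)
    where open ≡-Reasoning

module _ {n} {x : Fin n → ℚ} (π : Permutation′ n) (x∘π≡-x : ∀ i → x (π ⟨$⟩ʳ i) ≡ ℚ.- x i) where

  sum-even-antipodal : ∀ (g : ℚ → ℚ) → g 0ℚ ≡ 0ℚ → (∀ y → g (ℚ.- y) ≡ g y) →
    ℚΣ.sum (g ∘ x) ≡ ℚΣ.sum (g ∘ _⁺ ∘ x) ℚ.+ ℚΣ.sum (g ∘ _⁺ ∘ x)
  sum-even-antipodal g g0≡0 g-even = begin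
    ℚΣ.sum (g ∘ x)                                  ≡⟨ ℚΣ.sum-cong-≗ (even-split g g0≡0 g-even ∘ x) ⟩
    ℚΣ.sum (λ i → g (x i ⁺) ℚ.+ g ((ℚ.- x i) ⁺))    ≡⟨ ℚΣ.∑-distrib-+ (g ∘ _⁺ ∘ x) _ ⟩
    G ℚ.+ ℚΣ.sum (λ i → g ((ℚ.- x i) ⁺))            ≡⟨ cong (G ℚ.+_) (ℚΣ.sum-cong-≗ (cong (g ∘ _⁺) ∘ x∘π≡-x)) ⟨
    G ℚ.+ ℚΣ.sum (g ∘ _⁺ ∘ x ∘ (π ⟨$⟩ʳ_))           ≡⟨ cong (G ℚ.+_) (ℚΣ.sum-permute (g ∘ _⁺ ∘ x) π) ⟨
    G ℚ.+ G                                         ∎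
    where
    open ≡-Reasoning
    G : ℚ
    G = ℚΣ.sum (g ∘ _⁺ ∘ x)

  positive-count : sum ([0<_] ∘ x) + sum ([0<_] ∘ x) ≤ n
  positive-count = begin
    C + C                                       ≡⟨ cong (λ t → C + t) (sum-permute ([0<_] ∘ x) π) ⟩
    C + sum ([0<_] ∘ x ∘ (π ⟨$⟩ʳ_))             ≡⟨ ∑-distrib-+ ([0<_] ∘ x) _ ⟨
    sum (λ i → [0< x i ] + [0< x (π ⟨$⟩ʳ i) ])
      ≡⟨ sum-cong-≗ (λ i → cong (λ y → [0< x i ] + [0< y ]) (x∘π≡-x i)) ⟩
    sum (λ i → [0< x i ] + [0< ℚ.- x i ])       ≤⟨ sum-≤-length ([0<y]+[0<-y]≤1 ∘ x) ⟩
    n                                           ∎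
    where
    open ≤-Reasoning
    C : ℕ
    C = sum ([0<_] ∘ x)

monomial : ∀ {m} → Fin m → Fin m → ℚ
monomial zero    zero    = 1ℚ
monomial zero    (suc _) = 0ℚ
monomial (suc _) zero    = 0ℚ
monomial (suc j) (suc k) = monomial j k

sumFin-0* : ∀ m (g : Fin m → ℚ) → sumFin m (λ k → 0ℚ ℚ.* g k) ≡ 0ℚ
sumFin-0* zero    g = refl
sumFin-0* (suc m) g = cong₂ ℚ._+_ (ℚP.*-zeroˡ (g zero)) (sumFin-0* m (g ∘ suc))

sumFin-monomial : ∀ {m} (j : Fin m) (g : Fin m → ℚ) → sumFin m (λ k → monomial j k ℚ.* g k) ≡ g j
sumFin-monomial {suc m} zero    g =
  trans (cong₂ ℚ._+_ (ℚP.*-identityˡ (g zero)) (sumFin-0* m (g ∘ suc))) (ℚP.+-identityʳ (g zero))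
sumFin-monomial {suc m} (suc j) g =
  trans (cong₂ ℚ._+_ (ℚP.*-zeroˡ (g zero)) (sumFin-monomial j (g ∘ suc))) (ℚP.+-identityˡ (g (suc j)))

design-power-sum : ∀ {m n} .{{_ : NonZero n}} {x : Fin n → ℚ} → IsChebDesign m n x →
  ∀ e → e ≤ m → ℚΣ.sum (λ i → x i ^ℚ e) ≡ fromℕ n ℚ.* chebMoment e
design-power-sum {m} {n} {x} (_ , _ , exact) e e≤m = begin
  S                                      ≡⟨ ℚP.*-identityˡ S ⟨
  1ℚ ℚ.* S                               ≡⟨ cong (ℚ._* S) (fromℕ*[1/n]≡1 n) ⟨
  fromℕ n ℚ.* (+ 1 ℚ./ n) ℚ.* S          ≡⟨ ℚP.*-assoc (fromℕ n) (+ 1 ℚ./ n) S ⟩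
  fromℕ n ℚ.* ((+ 1 ℚ./ n) ℚ.* S)        ≡⟨ cong (λ t → fromℕ n ℚ.* ((+ 1 ℚ./ n) ℚ.* t)) S≡Σf ⟩
  fromℕ n ℚ.* ((+ 1 ℚ./ n) ℚ.* sumFin n (λ i → eval f (x i)))  ≡⟨ cong (fromℕ n ℚ.*_) (exact f) ⟩
  fromℕ n ℚ.* chebIntegral f             ≡⟨ cong (fromℕ n ℚ.*_) (sumFin-monomial j (chebMoment ∘ toℕ)) ⟩
  fromℕ n ℚ.* chebMoment (toℕ j)         ≡⟨ cong (λ k → fromℕ n ℚ.* chebMoment k) (toℕ-fromℕ< e<1+m) ⟩
  fromℕ n ℚ.* chebMoment e               ∎
  where
  open ≡-Reasoning
  e<1+m : e < suc m
  e<1+m = s≤s e≤m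
  j : Fin (suc m)
  j = fromℕ< e<1+m
  f : Poly m
  f = monomial j
  S : ℚ
  S = ℚΣ.sum (λ i → x i ^ℚ e)
  S≡Σf : S ≡ sumFin n (λ i → eval f (x i))
  S≡Σf = sym (trans (sumFin≡sum n _) (ℚΣ.sum-cong-≗ λ i →
           trans (sumFin-monomial j (λ k → x i ^ℚ toℕ k)) (cong (x i ^ℚ_) (toℕ-fromℕ< e<1+m))))

fromℕ-powerSum : ∀ {n} {a : Fin n → ℚ} {Q} {P : Fin n → ℕ} → (∀ i → a i ℚ.* fromℕ Q ≡ fromℕ (P i)) →
  ∀ k → fromℕ (powerSum k P) ≡ ℚΣ.sum (λ i → a i ^ℚ k) ℚ.* fromℕ (Q ^ k)
fromℕ-powerSum {a = a} {Q} {P} aQ≡P k = begin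
  fromℕ (powerSum k P)                            ≡⟨ fromℕ-sum (λ i → P i ^ k) ⟩
  ℚΣ.sum (λ i → fromℕ (P i ^ k))                  ≡⟨ ℚΣ.sum-cong-≗ scale ⟩
  ℚΣ.sum (λ i → a i ^ℚ k ℚ.* fromℕ (Q ^ k))       ≡⟨ ℚΣ.*-distribʳ-sum (fromℕ (Q ^ k)) (λ i → a i ^ℚ k) ⟨
  ℚΣ.sum (λ i → a i ^ℚ k) ℚ.* fromℕ (Q ^ k)       ∎
  where
  open ≡-Reasoning
  scale : ∀ i → fromℕ (P i ^ k) ≡ a i ^ℚ k ℚ.* fromℕ (Q ^ k)
  scale i = begin
    fromℕ (P i ^ k)                    ≡⟨ fromℕ-^ (P i) k ⟩
    fromℕ (P i) ^ℚ k                   ≡⟨ cong (_^ℚ k) (aQ≡P i) ⟨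
    (a i ℚ.* fromℕ Q) ^ℚ k             ≡⟨ *-^ℚ-distrib (a i) (fromℕ Q) k ⟩
    a i ^ℚ k ℚ.* fromℕ Q ^ℚ k          ≡⟨ cong (a i ^ℚ k ℚ.*_) (fromℕ-^ Q k) ⟨
    a i ^ℚ k ℚ.* fromℕ (Q ^ k)         ∎

clear-denominators : ∀ {A μ : ℚ} d c n S R → fromℕ d ℚ.* μ ≡ fromℕ c →
  A ℚ.+ A ≡ fromℕ n ℚ.* μ → fromℕ S ≡ A ℚ.* fromℕ R → (d + d) * S ≡ c * (n * R)
clear-denominators {A} {μ} d c n S R dμ≡c 2A≡nμ S≡AR = fromℕ-injective (begin
  fromℕ ((d + d) * S)                ≡⟨ trans (fromℕ-* (d + d) S) (cong₂ ℚ._*_ (fromℕ-+ d d) S≡AR) ⟩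
  (D ℚ.+ D) ℚ.* (A ℚ.* R̂)
    ≡⟨ solve 3 (λ D A R → (D :+ D) :* (A :* R) := D :* (A :+ A) :* R) refl D A R̂ ⟩
  D ℚ.* (A ℚ.+ A) ℚ.* R̂              ≡⟨ cong (λ t → D ℚ.* t ℚ.* R̂) 2A≡nμ ⟩
  D ℚ.* (N̂ ℚ.* μ) ℚ.* R̂
    ≡⟨ solve 4 (λ D N μ R → D :* (N :* μ) :* R := D :* μ :* (N :* R)) refl D N̂ μ R̂ ⟩
  D ℚ.* μ ℚ.* (N̂ ℚ.* R̂)              ≡⟨ cong (ℚ._* (N̂ ℚ.* R̂)) dμ≡c ⟩
  fromℕ c ℚ.* (N̂ ℚ.* R̂)              ≡⟨ trans (fromℕ-* c (n * R)) (cong (fromℕ c ℚ.*_) (fromℕ-* n R)) ⟨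
  fromℕ (c * (n * R))                ∎)
  where
  open ≡-Reasoning
  open ℚSolver
  D N̂ R̂ : ℚ
  D = fromℕ d
  N̂ = fromℕ n
  R̂ = fromℕ R

antipodal-design⇒integer-solution : ∀ {m n} .{{_ : NonZero n}} {x : Fin n → ℚ} →
  IsChebDesign (4 + m) n x → IsAntipodal x →
  Σ ℕ λ Q → Q ≢ 0 × Σ (Fin n → ℕ) λ P → nonZeroCount P + nonZeroCount P ≤ n
    × 4 * powerSum 2 P ≡ n * Q ^ 2 × 16 * powerSum 4 P ≡ 3 * (n * Q ^ 4)
antipodal-design⇒integer-solution {m} {n} {x} design@(x-injective , _) (antipode , _)
  with reflection x-injective antipode | common-denominator (_⁺ ∘ x) (⁺-nonneg ∘ x)
... | π , x∘π≡-x | Q , Q≢0 , P , x⁺Q≡P =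
  Q , Q≢0 , P , count ,
  trans (moment 0 (s≤s (s≤s z≤n)) 2 1 refl) (ℕP.*-identityˡ _) , moment 1 (ℕP.m≤m+n 4 m) 8 3 refl
  where
  count : nonZeroCount P + nonZeroCount P ≤ n
  count = ≤-trans (+-mono-≤ supp supp) (positive-count π x∘π≡-x)
    where
    supp : nonZeroCount P ≤ sum ([0<_] ∘ x)
    supp = sum-mono-≤ (λ i → [≢0]≤[0<] (x i) {Q} (x⁺Q≡P i))
  moment : ∀ k → suc k * 2 ≤ 4 + m → ∀ d c → fromℕ d ℚ.* chebMoment (suc k * 2) ≡ fromℕ c →
    (d + d) * powerSum (suc k * 2) P ≡ c * (n * Q ^ (suc k * 2))
  moment k e≤4+m d c dμ≡c =
    clear-denominators {A = ℚΣ.sum (λ i → x i ⁺ ^ℚ e)} d c n (powerSum e P) (Q ^ e) dμ≡c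
      (trans (sym (sum-even-antipodal π x∘π≡-x (_^ℚ e) (ℚP.*-zeroˡ (0ℚ ^ℚ suc (k * 2)))
                                                      (λ y → neg-^ℚ-even y (suc k))))
             (design-power-sum design e e≤4+m))
      (fromℕ-powerSum {a = _⁺ ∘ x} {Q} {P} x⁺Q≡P e)
    where
    e : ℕ
    e = suc k * 2

theorem8p1 : (N : ℕ) → 1 ≤ N → N ≤ 16 →
    ¬ (Σ (Fin (suc (2 * N)) → ℚ) λ x → IsChebDesign 5 (suc (2 * N)) x × IsAntipodal x)
theorem8p1 N _ N≤16 (x , design , antipodal) =
  let Q , Q≢0 , P , count , e₂ , e₄ = antipodal-design⇒integer-solution design antipodal
      supp : nonZeroCount P ≤ 16
      supp = ≮⇒≥ λ 16<c → 1+n≰n (begin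
        34                                  ≤⟨ +-mono-≤ 16<c 16<c ⟩
        nonZeroCount P + nonZeroCount P     ≤⟨ count ⟩
        suc (2 * N)                         ≤⟨ s≤s (*-monoʳ-≤ 2 N≤16) ⟩
        33                                  ∎)
  in power-sum-equations-unsolvable P N Q Q≢0 supp
       (subst (λ m → 4 * powerSum 2 P ≡ m * Q ^ 2) n≡1+N*2 e₂)
       (subst (λ m → 16 * powerSum 4 P ≡ 3 * (m * Q ^ 4)) n≡1+N*2 e₄)
  where
  open ≤-Reasoning
  n≡1+N*2 : suc (2 * N) ≡ 1 + N * 2
  n≡1+N*2 = cong suc (*-comm 2 N)
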